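{- Let $P$ be a dealing pattern, $N\ge 1$, and let $P'$ be the pattern obtained from $P$ by deleting its first $N$ letters. Then \[F^{P}(N)=\begin{cases} N, & \text{if } d_N(P)=N,\\ u_{m}(P)\ \text{ with } m=F^{P'}\bigl(|P_N|_U\bigr), & \text{otherwise.}\end{cases}\]
   Context: A dealing pattern $P=P_1P_2P_3\cdots$ is an infinite sequence of letters $U$ and $D$ containing infinitely many $D$'s. Dealing a deck of $N$ cards (positions $1,\dots,N$ from the top) by $P$ means: process the letters in order; for a $U$ move the top card to the bottom; for a $D$ remove the top card (deal it); stop when all $N$ cards are dealt. $F^P(N)$ is the initial position of the last card dealt (the "freed person" in the corresponding Josephus problem). $d_i(P)$, $u_i(P)$ denote the index (starting from 1) of the $i$th occurrence of $D$, resp. $U$, in $P$; $|P_N|_U$ is the number of $U$'s among the first $N$ letters of $P$. -}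

module Defs where

open import Data.Nat using (ℕ; zero; suc; _+_; _∸_; _≤_)
open import Data.Nat.Properties using (+-monoʳ-≤; ≤-trans; m≤m+n)
open import Data.List using (List; []; _∷_; _++_; [_]; map; upTo)
open import Data.Product using (Σ; _×_; _,_; proj₁; proj₂)
open import Relation.Binary.PropositionalEquality using (_≡_)

data Letter : Set where
  U D : Letter

-- An infinite word P₁P₂P₃⋯ is represented as a function ℕ → Letter,
-- with the 0-based convention: P i is the letter P_{i+1}.
Pattern : Set
Pattern = ℕ → Letter

InfD : Pattern → Set
InfD P = (n : ℕ) → Σ ℕ (λ m → n ≤ m × P m ≡ D)

-- A dealing pattern is a pattern with infinitely many D's
-- (we carry the proof InfD P as a separate argument).

dropP : ℕ → Pattern → Pattern
dropP N P i = P (N + i)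

dropInf : (N : ℕ) (P : Pattern) → InfD P → InfD (dropP N P)
dropInf N P inf n with inf (N + n)
... | m , le , eq = (m ∸ N) , helper
  where
  open import Data.Nat.Properties using (m+[n∸m]≡n; m≤n+m; +-cancelˡ-≤; ≤-trans)
  open import Relation.Binary.PropositionalEquality using (subst; sym; cong)
  N≤m : N ≤ m
  N≤m = ≤-trans (m≤m+n N n) le
  eqm : N + (m ∸ N) ≡ m
  eqm = m+[n∸m]≡n N≤m
  helper : n ≤ m ∸ N × P (N + (m ∸ N)) ≡ D
  helper = +-cancelˡ-≤ N n (m ∸ N) (subst (N + n ≤_) (sym eqm) le)
         , subst (λ k → P k ≡ D) (sym eqm) eq

isLetter : Letter → Letter → ℕ
isLetter U U = 1
isLetter D D = 1
isLetter _ _ = 0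

count : Letter → Pattern → ℕ → ℕ
count c P zero = 0
count c P (suc n) = count c P n + isLetter c (P n)

-- IsNth c P i n : i (1-based) is the index of the n-th occurrence of c in P,
-- i.e. P_i = c and exactly n occurrences of c among P_1 … P_i.
-- Thus "d_n(P) = i" is IsNth D P i n and "u_n(P) = i" is IsNth U P i n.
IsNth : Letter → Pattern → ℕ → ℕ → Set
IsNth c P i n = 1 ≤ i × P (i ∸ 1) ≡ c × count c P i ≡ n

-- Dealing.  The deck is a list of initial positions (top first).
rotate : List ℕ → List ℕ
rotate [] = []
rotate (x ∷ xs) = xs ++ [ x ]

-- The fuel is the distance to a known D, so the search always ends at a D.
advance : Pattern → ℕ → ℕ → List ℕ → List ℕ × ℕ
advance P zero i deck = deck , i
advance P (suc f) i deck with P i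
... | D = deck , i
... | U = advance P f (suc i) (rotate deck)

-- deal P inf n i deck : n cards remain in `deck`, next letter to process is P i;
-- returns the initial position of the last card dealt.
deal : (P : Pattern) → InfD P → ℕ → ℕ → List ℕ → ℕ
deal P inf zero i deck = 0
deal P inf (suc n) i deck with advance P (proj₁ (inf i) ∸ i) i deck
... | [] , j = 0
... | x ∷ rest , j with n
...   | zero = x
...   | suc n' = deal P inf (suc n') (suc j) rest

F : (P : Pattern) → InfD P → ℕ → ℕ
F P inf N = deal P inf N 0 (map suc (upTo N))

{-# OPTIONS --safe #-}
module Submission where

-- While the first N letters are read, the card on top at letter P_{j+1} is card j+1: a D
-- deals it and a U sends it to the bottom.  If all N letters are D, the cards are dealt in
-- order and N is last.  Otherwise, after N letters the deck is u_1(P), …, u_k(P) with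
-- k = |P_N|_U, and the rest of the deal is P' dealing this deck; since dealing only permutes
-- and removes cards, card m of a fresh deck of k cards corresponds to card u_m(P).

open import Defs
open import Data.Nat using (ℕ; zero; suc; _+_; _∸_; _≤_; _<_; z≤n; s≤s; z<s)
open import Data.Nat.Properties
  using (+-identityʳ; +-suc; +-comm; +-cancelʳ-≡; +-mono-≤; ≤-refl; ≤-trans; ≤-reflexive;
         m+n≡0⇒m≡0; m+n≡0⇒n≡0; m<1+n⇒m<n∨m≡n; m<m+n; n<1+n; n≢0⇒n>0; suc-injective;
         m+[n∸m]≡n; +-commutativeSemigroup)
open import Algebra.Properties.CommutativeSemigroup +-commutativeSemigroup using (interchange)
open import Data.Product using (_×_; _,_; proj₁)
open import Data.Sum using (inj₁; inj₂)
open import Data.Empty using (⊥-elim)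
open import Function using (_∘_)
open import Data.List using (List; []; _∷_; _++_; [_]; _∷ʳ_; map; upTo; applyUpTo; length)
open import Data.List.Properties
  using (++-assoc; ++-identityʳ; length-++; length-map; length-upTo; map-++; map-upTo; upTo-∷ʳ)
open import Data.List.Relation.Binary.Pointwise using (Pointwise; []; _∷_; ++⁺)
open import Relation.Nullary using (¬_)
open import Relation.Binary.PropositionalEquality
  using (_≡_; _≢_; refl; sym; trans; cong; cong₂; subst; subst₂; module ≡-Reasoning)
open ≡-Reasoning

U≢D : U ≢ D
U≢D ()

isLetter-≤1 : ∀ c l → isLetter c l ≤ 1
isLetter-≤1 U U = ≤-refl
isLetter-≤1 U D = z≤n
isLetter-≤1 D U = z≤n
isLetter-≤1 D D = ≤-refl

isLetter-U+D : ∀ l → isLetter U l + isLetter D l ≡ 1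
isLetter-U+D U = refl
isLetter-U+D D = refl

isLetter-U≡0⇒D : ∀ l → isLetter U l ≡ 0 → l ≡ D
isLetter-U≡0⇒D D _ = refl

count-+≤ : ∀ c P m n → count c P (m + n) ≤ count c P m + n
count-+≤ c P m zero rewrite +-identityʳ m | +-identityʳ (count c P m) = ≤-refl
count-+≤ c P m (suc n) rewrite +-suc m n | +-suc (count c P m) n =
  ≤-trans (+-mono-≤ (count-+≤ c P m n) (isLetter-≤1 c (P (m + n))))
          (≤-reflexive (+-comm (count c P m + n) 1))

count-U+D : ∀ P n → count U P n + count D P n ≡ n
count-U+D P zero = refl
count-U+D P (suc n) = begin
  count U P n + isLetter U (P n) + (count D P n + isLetter D (P n))
    ≡⟨ interchange (count U P n) _ (count D P n) _ ⟩
  count U P n + count D P n + (isLetter U (P n) + isLetter D (P n))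
    ≡⟨ cong₂ _+_ (count-U+D P n) (isLetter-U+D (P n)) ⟩
  n + 1
    ≡⟨ +-comm n 1 ⟩
  suc n ∎

count-D≡n⇒count-U≡0 : ∀ P n → count D P n ≡ n → count U P n ≡ 0
count-D≡n⇒count-U≡0 P n cD≡n =
  +-cancelʳ-≡ n _ 0 (trans (cong (count U P n +_) (sym cD≡n)) (count-U+D P n))

count-U≡0⇒count-D≡n : ∀ P n → count U P n ≡ 0 → count D P n ≡ n
count-U≡0⇒count-D≡n P n cU≡0 = trans (cong (_+ count D P n) (sym cU≡0)) (count-U+D P n)

count-U≡0⇒D : ∀ P n → count U P n ≡ 0 → ∀ {m} → m < n → P m ≡ D
count-U≡0⇒D P (suc n) cU≡0 m<1+n with m<1+n⇒m<n∨m≡n m<1+n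
... | inj₁ m<n  = count-U≡0⇒D P n (m+n≡0⇒m≡0 _ cU≡0) m<n
... | inj₂ refl = isLetter-U≡0⇒D (P n) (m+n≡0⇒n≡0 _ cU≡0)

count-U-step-U : ∀ {P j} → P j ≡ U → count U P (suc j) ≡ suc (count U P j)
count-U-step-U {P} {j} eq rewrite eq = +-comm (count U P j) 1

count-U-step-D : ∀ {P j} → P j ≡ D → count U P (suc j) ≡ count U P j
count-U-step-D {P} {j} eq rewrite eq = +-identityʳ (count U P j)

uPositions : Pattern → ℕ → List ℕ
uPositions P zero = []
uPositions P (suc j) with P j
... | U = uPositions P j ∷ʳ suc j
... | D = uPositions P j

uPositions-step-U : ∀ {P j} → P j ≡ U → uPositions P (suc j) ≡ uPositions P j ∷ʳ suc j
uPositions-step-U eq rewrite eq = refl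

uPositions-step-D : ∀ {P j} → P j ≡ D → uPositions P (suc j) ≡ uPositions P j
uPositions-step-D eq rewrite eq = refl

map-suc-upTo-∷ʳ : ∀ k → map suc (upTo (k + 1)) ≡ map suc (upTo k) ∷ʳ suc k
map-suc-upTo-∷ʳ k = begin
  map suc (upTo (k + 1))   ≡⟨ cong (map suc ∘ upTo) (+-comm k 1) ⟩
  map suc (upTo (suc k))   ≡⟨ cong (map suc) (sym (upTo-∷ʳ k)) ⟩
  map suc (upTo k ∷ʳ k)    ≡⟨ map-++ suc (upTo k) [ k ] ⟩
  map suc (upTo k) ∷ʳ suc k ∎

length-map-suc-upTo : ∀ k → length (map suc (upTo k)) ≡ k
length-map-suc-upTo k = trans (length-map suc (upTo k)) (length-upTo k)

uPositions-IsNth : ∀ P j → Pointwise (IsNth U P) (uPositions P j) (map suc (upTo (count U P j)))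
uPositions-IsNth P zero = []
uPositions-IsNth P (suc j) with P j in eq
... | U = subst (Pointwise (IsNth U P) (uPositions P j ∷ʳ suc j))
                (sym (map-suc-upTo-∷ʳ (count U P j)))
                (++⁺ (uPositions-IsNth P j) ((s≤s z≤n , eq , count-U-step-U {P} eq) ∷ []))
... | D = subst (Pointwise (IsNth U P) (uPositions P j) ∘ map suc ∘ upTo)
                (sym (+-identityʳ (count U P j)))
                (uPositions-IsNth P j)

consecutive : ℕ → ℕ → List ℕ
consecutive j zero    = []
consecutive j (suc r) = suc j ∷ consecutive (suc j) r

applyUpTo-consecutive : ∀ {f} j r → (∀ t → f t ≡ suc (j + t)) → applyUpTo f r ≡ consecutive j r
applyUpTo-consecutive j zero    f≗ = refl
applyUpTo-consecutive j (suc r) f≗ =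
  cong₂ _∷_ (trans (f≗ 0) (cong suc (+-identityʳ j)))
            (applyUpTo-consecutive (suc j) r (λ t → trans (f≗ (suc t)) (cong suc (+-suc j t))))

map-suc-upTo≡consecutive : ∀ n → map suc (upTo n) ≡ consecutive 0 n
map-suc-upTo≡consecutive n = trans (map-upTo suc n) (applyUpTo-consecutive 0 n (λ _ → refl))

length-rotate : ∀ xs → length (rotate xs) ≡ length xs
length-rotate []       = refl
length-rotate (x ∷ xs) = trans (length-++ xs) (+-comm (length xs) 1)

rotate⁺ : ∀ {R : ℕ → ℕ → Set} {xs ys} → Pointwise R xs ys → Pointwise R (rotate xs) (rotate ys)
rotate⁺ []         = []
rotate⁺ (x∼y ∷ pw) = ++⁺ pw (x∼y ∷ [])

module _ {P : Pattern} where

  advance-D : ∀ {i deck} → P i ≡ D → ∀ f → advance P f i deck ≡ (deck , i)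
  advance-D eq zero    = refl
  advance-D eq (suc f) rewrite eq = refl

  advance-U : ∀ {i f deck} → P i ≡ U → advance P (suc f) i deck ≡ advance P f (suc i) (rotate deck)
  advance-U eq rewrite eq = refl

  -- Any fuel that reaches a D gives the same result, so `deal` does not depend on the InfD proof.
  advance-fuel-irrelevant : ∀ f g {i deck} → P (i + f) ≡ D → P (i + g) ≡ D →
                            advance P f i deck ≡ advance P g i deck
  advance-fuel-irrelevant zero    zero        _  _  = refl
  advance-fuel-irrelevant zero    (suc g) {i} ef _  =
    sym (advance-D (subst ((_≡ D) ∘ P) (+-identityʳ i) ef) (suc g))
  advance-fuel-irrelevant (suc f) zero    {i} _  eg =
    advance-D (subst ((_≡ D) ∘ P) (+-identityʳ i) eg) (suc f)
  advance-fuel-irrelevant (suc f) (suc g) {i} ef eg with P i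
  ... | D = refl
  ... | U = advance-fuel-irrelevant f g (subst ((_≡ D) ∘ P) (+-suc i f) ef)
                                        (subst ((_≡ D) ∘ P) (+-suc i g) eg)

-- Syntactically the fuel `deal` passes to `advance`, so unfolding `deal` meets it as is.
fuel : {P : Pattern} → InfD P → ℕ → ℕ
fuel inf i = proj₁ (inf i) ∸ i

module _ {P : Pattern} (inf : InfD P) where

  fuel-reaches-D : ∀ i → P (i + fuel inf i) ≡ D
  fuel-reaches-D i with inf i
  ... | m , i≤m , eq = subst ((_≡ D) ∘ P) (sym (m+[n∸m]≡n i≤m)) eq

  deal-advance-cong : ∀ {n i j d e} → advance P (fuel inf i) i d ≡ advance P (fuel inf j) j e →
                      deal P inf (suc n) i d ≡ deal P inf (suc n) j e
  deal-advance-cong {n} {i} {j} {d} {e} eq rewrite eq with advance P (fuel inf j) j e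
  ... | []    , _ = refl
  ... | _ ∷ _ , _ with n
  ...   | zero  = refl
  ...   | suc _ = refl

  deal-U : ∀ {n i d} → P i ≡ U → deal P inf (suc n) i d ≡ deal P inf (suc n) (suc i) (rotate d)
  deal-U {n} {i} {d} eq = deal-advance-cong {n} {i} {suc i} {d} {rotate d} (trans
    (advance-fuel-irrelevant (fuel inf i) (suc (fuel inf (suc i)))
       (fuel-reaches-D i) (subst ((_≡ D) ∘ P) (sym (+-suc i _)) (fuel-reaches-D (suc i))))
    (advance-U {P = P} {deck = d} eq))

  deal-last : ∀ {i x d} → P i ≡ D → deal P inf 1 i (x ∷ d) ≡ x
  deal-last {i} {x} {d} eq with advance P (fuel inf i) i (x ∷ d) | advance-D {P = P} {deck = x ∷ d} eq (fuel inf i)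
  ... | _ | refl = refl

  deal-D : ∀ {n i x d} → P i ≡ D → deal P inf (suc (suc n)) i (x ∷ d) ≡ deal P inf (suc n) (suc i) d
  deal-D {i = i} {x} {d} eq with advance P (fuel inf i) i (x ∷ d) | advance-D {P = P} {deck = x ∷ d} eq (fuel inf i)
  ... | _ | refl = refl

  deal-allD : ∀ j r → (∀ {m} → m < j + suc r → P m ≡ D) →
              deal P inf (suc r) j (consecutive j (suc r)) ≡ j + suc r
  deal-allD j zero    allD = trans (deal-last (allD (m<m+n j {1} z<s))) (sym (+-comm j 1))
  deal-allD j (suc r) allD = begin
    deal P inf (suc (suc r)) j (suc j ∷ consecutive (suc j) (suc r))
      ≡⟨ deal-D (allD (m<m+n j {suc (suc r)} z<s)) ⟩
    deal P inf (suc r) (suc j) (consecutive (suc j) (suc r))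
      ≡⟨ deal-allD (suc j) r (λ {m} → allD ∘ subst (m <_) (sym (+-suc j (suc r)))) ⟩
    suc j + suc r
      ≡⟨ sym (+-suc j (suc r)) ⟩
    j + suc (suc r) ∎

  deal-uPositions : ∀ j r → 1 ≤ count U P (j + r) →
    deal P inf (count U P j + r) j (consecutive j r ++ uPositions P j) ≡
    deal P inf (count U P (j + r)) (j + r) (uPositions P (j + r))
  deal-uPositions j zero _ rewrite +-identityʳ j | +-identityʳ (count U P j) = refl
  deal-uPositions j (suc r) 1≤cU rewrite +-suc j r | +-suc (count U P j) r with P j in eq
  ... | U = begin
    deal P inf (suc (count U P j + r)) j (suc j ∷ consecutive (suc j) r ++ uPositions P j)
      ≡⟨ deal-U eq ⟩
    deal P inf (suc (count U P j + r)) (suc j) ((consecutive (suc j) r ++ uPositions P j) ∷ʳ suc j)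
      ≡⟨ cong₂ (λ n d → deal P inf n (suc j) d)
               (cong (_+ r) (sym (count-U-step-U {P} {j} eq)))
               (trans (++-assoc (consecutive (suc j) r) _ _)
                      (cong (consecutive (suc j) r ++_) (sym (uPositions-step-U {P} {j} eq)))) ⟩
    deal P inf (count U P (suc j) + r) (suc j) (consecutive (suc j) r ++ uPositions P (suc j))
      ≡⟨ deal-uPositions (suc j) r 1≤cU ⟩
    deal P inf (count U P (suc (j + r))) (suc (j + r)) (uPositions P (suc (j + r))) ∎
  ... | D = begin
    deal P inf (suc (count U P j + r)) j (suc j ∷ consecutive (suc j) r ++ uPositions P j)
      ≡⟨ deal-D′ ⟩
    deal P inf (count U P j + r) (suc j) (consecutive (suc j) r ++ uPositions P j)
      ≡⟨ cong₂ (λ n d → deal P inf n (suc j) d)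
               (cong (_+ r) (sym (count-U-step-D {P} {j} eq)))
               (cong (consecutive (suc j) r ++_) (sym (uPositions-step-D {P} {j} eq))) ⟩
    deal P inf (count U P (suc j) + r) (suc j) (consecutive (suc j) r ++ uPositions P (suc j))
      ≡⟨ deal-uPositions (suc j) r 1≤cU ⟩
    deal P inf (count U P (suc (j + r))) (suc (j + r)) (uPositions P (suc (j + r))) ∎
    where
    -- The deck still holds count U P j + r ≥ count U P (j + 1 + r) ≥ 1 cards after this D.
    1≤cards : 1 ≤ count U P j + r
    1≤cards = ≤-trans 1≤cU (subst (λ c → count U P (suc j + r) ≤ c + r) (count-U-step-D {P} {j} eq)
                                  (count-+≤ U P (suc j) r))
    deal-D′ : ∀ {x d} → deal P inf (suc (count U P j + r)) j (x ∷ d) ≡ deal P inf (count U P j + r) (suc j) d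
    deal-D′ with count U P j + r | 1≤cards
    ... | suc _ | _ = deal-D eq

module _ {P : Pattern} (inf : InfD P) {N : ℕ} (inf′ : InfD (dropP N P)) where

  deal-dropP : ∀ {R : ℕ → ℕ → Set} {n} i {d₁ d₂} → 1 ≤ n → Pointwise R d₁ d₂ → length d₂ ≡ n →
               R (deal P inf n (N + i) d₁) (deal (dropP N P) inf′ n i d₂)
  deal-dropP {R} i (s≤s z≤n) = go _ (fuel inf′ i) i (fuel-reaches-D inf′ i)
    where
    shift : ∀ {n j d} → deal P inf n (suc (N + j)) d ≡ deal P inf n (N + suc j) d
    shift {n} {j} {d} = cong (λ k → deal P inf n k d) (sym (+-suc N j))

    go : ∀ n f j {d₁ d₂} → P (N + (j + f)) ≡ D → Pointwise R d₁ d₂ → length d₂ ≡ suc n →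
         R (deal P inf (suc n) (N + j) d₁) (deal (dropP N P) inf′ (suc n) j d₂)
    go n f j ef pw len with P (N + j) in eq
    go n zero    j ef pw len | U =
      ⊥-elim (U≢D (trans (sym eq) (subst (λ k → P (N + k) ≡ D) (+-identityʳ j) ef)))
    go n (suc f) j {d₁} {d₂} ef pw len | U =
      subst₂ R (sym (trans (deal-U inf eq) shift)) (sym (deal-U inf′ eq))
        (go n f (suc j) (subst (λ k → P (N + k) ≡ D) (+-suc j f) ef) (rotate⁺ pw)
            (trans (length-rotate d₂) len))
    go zero    f j ef (x∼y ∷ _) len | D =
      subst₂ R (sym (deal-last inf eq)) (sym (deal-last inf′ eq)) x∼y
    go (suc n) f j ef (_ ∷ pw) len | D =
      subst₂ R (sym (trans (deal-D inf eq) shift)) (sym (deal-D inf′ eq))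
        (go n (fuel inf′ (suc j)) (suc j) (fuel-reaches-D inf′ (suc j)) pw (suc-injective len))

F-allD : ∀ {P} (inf : InfD P) N → (∀ {m} → m < N → P m ≡ D) → F P inf N ≡ N
F-allD inf zero    _    = refl
F-allD {P} inf (suc N) allD =
  trans (cong (deal P inf (suc N) 0) (map-suc-upTo≡consecutive (suc N))) (deal-allD inf 0 N allD)

F-someU : ∀ {P} (inf : InfD P) N (inf′ : InfD (dropP N P)) → 1 ≤ count U P N →
          IsNth U P (F P inf N) (F (dropP N P) inf′ (count U P N))
F-someU {P} inf N inf′ 1≤cU =
  subst (λ c → IsNth U P c (F (dropP N P) inf′ (count U P N))) (sym F≡)
    (deal-dropP inf inf′ 0 1≤cU (uPositions-IsNth P N) (length-map-suc-upTo (count U P N)))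
  where
  F≡ : F P inf N ≡ deal P inf (count U P N) (N + 0) (uPositions P N)
  F≡ = begin
    deal P inf N 0 (map suc (upTo N))
      ≡⟨ cong (deal P inf N 0) (trans (map-suc-upTo≡consecutive N) (sym (++-identityʳ _))) ⟩
    deal P inf N 0 (consecutive 0 N ++ [])
      ≡⟨ deal-uPositions inf 0 N 1≤cU ⟩
    deal P inf (count U P N) N (uPositions P N)
      ≡⟨ cong (λ i → deal P inf (count U P N) i (uPositions P N)) (sym (+-identityʳ N)) ⟩
    deal P inf (count U P N) (N + 0) (uPositions P N) ∎

mainTheorem8 : (P : Pattern) (inf : InfD P) (N : ℕ) → 1 ≤ N →
    (IsNth D P N N → F P inf N ≡ N) ×
    (¬ IsNth D P N N →
      IsNth U P (F P inf N) (F (dropP N P) (dropInf N P inf) (count U P N)))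
mainTheorem8 P inf (suc N) (s≤s z≤n) = allD-case , someU-case
  where
  allD-case : IsNth D P (suc N) (suc N) → F P inf (suc N) ≡ suc N
  allD-case (_ , _ , cD≡N) =
    F-allD inf (suc N) (count-U≡0⇒D P (suc N) (count-D≡n⇒count-U≡0 P (suc N) cD≡N))

  someU-case : ¬ IsNth D P (suc N) (suc N) →
               IsNth U P (F P inf (suc N)) (F (dropP (suc N) P) (dropInf (suc N) P inf) (count U P (suc N)))
  someU-case notAllD = F-someU inf (suc N) (dropInf (suc N) P inf) (n≢0⇒n>0 λ cU≡0 →
    notAllD (s≤s z≤n , count-U≡0⇒D P (suc N) cU≡0 (n<1+n N) , count-U≡0⇒count-D≡n P (suc N) cU≡0))
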